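{- Consider the following static algorithm on a set system $(\mathcal{S},\mathcal{E})$ with costs $1/C\le c_s\le 1$, $n=|\mathcal{E}|$, every element contained in at least one set, and $0<\epsilon<1/2$. Initialize $L=\lceil\log_{1+\epsilon}(Cn)\rceil+1$, $w(e)=(1+\epsilon)^{ -L}$ and $\ell(e)=L$ for every element, and $\ell(s)=L$ for every set. For rounds $t=L,L-1,\dots,1$: let $\mathcal{S}^{(t)}_{slack}=\{s\in\mathcal{S}: W(s)<(1+\epsilon)^{ -1}c_s\}$ (with $W(s)=\sum_{e\in s}w(e)$ computed at the beginning of the round) and $\mathcal{E}^{(t)}_{slack}=\{e\in\mathcal{E}: e\notin s\text{ for all } s\in\mathcal{S}\setminus\mathcal{S}^{(t)}_{slack}\}$; decrease $\ell(s)$ by one for every $s\in\mathcal{S}^{(t)}_{slack}$; for every $e\in\mathcal{E}^{(t)}_{slack}$ multiply $w(e)$ by $(1+\epsilon)$ and decrease $\ell(e)$ by one. Then at the end of this algorithm, every set $s\in\mathcal{S}$ satisfies $(1+\epsilon)^{ -1}c_s\le W(s)\le c_s$ if $\ell(s)>0$, and $0\le W(s)<(1+\epsilon)^{ -1}c_s$ if $\ell(s)=0$.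
   Formalization: The costs $c_s$, the bound C and the parameter $\epsilon$ take rational values. -}

module Defs where

open import Data.Nat as ℕ using (ℕ; zero; suc; _∸_)
open import Data.Fin using (Fin)
import Data.Fin as Fin
open import Data.Bool using (Bool; true; false; if_then_else_; _∨_; _∧_; not)
open import Data.Product using (_×_)
open import Data.Sum using (_⊎_)
open import Data.Integer using (+_)
open import Data.Rational hiding (round)
open import Data.Rational.Properties using (_<?_; +-mono-<)
open import Relation.Nullary using (does)
open import Relation.Binary.PropositionalEquality using (_≡_)

ℕtoℚ : ℕ → ℚ
ℕtoℚ k = + k / 1

pow : ℚ → ℕ → ℚ
pow p zero    = 1ℚ
pow p (suc k) = p * pow p k

inv : (p : ℚ) → 0ℚ < p → ℚ
inv p p>0 = 1/_ p {{>-nonZero p>0}}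

ρ : (ε : ℚ) → 0ℚ < ε → ℚ
ρ ε ε>0 = inv (1ℚ + ε) (+-mono-< {0ℚ} {1ℚ} {0ℚ} {ε} (*<* (Data.Integer.+<+ (ℕ.s≤s ℕ.z≤n))) ε>0)

sumFin : ∀ {k} → (Fin k → ℚ) → ℚ
sumFin {zero}  f = 0ℚ
sumFin {suc k} f = f Fin.zero + sumFin (λ i → f (Fin.suc i))

allFinB : ∀ {k} → (Fin k → Bool) → Bool
allFinB {zero}  f = true
allFinB {suc k} f = f Fin.zero ∧ allFinB (λ i → f (Fin.suc i))

-- K = max(0, ⌈log_{1+ε} x⌉): the least natural K with x ≤ (1+ε)^K
IsCeilLog : (ε x : ℚ) → ℕ → Set
IsCeilLog ε x K = (x ≤ pow (1ℚ + ε) K) × (K ≡ 0 ⊎ pow (1ℚ + ε) (K ∸ 1) < x)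

record State (n m : ℕ) : Set where
  field
    w  : Fin n → ℚ
    ℓE : Fin n → ℕ
    ℓS : Fin m → ℕ
open State public

-- A set system with sets indexed by Fin m over elements Fin n:
-- mem s e = true  iff  e ∈ s.
module Algorithm {n m : ℕ} (mem : Fin m → Fin n → Bool) (c : Fin m → ℚ)
                 (ε : ℚ) (ε>0 : 0ℚ < ε) where

  W : State n m → Fin m → ℚ
  W st s = sumFin (λ e → if mem s e then w st e else 0ℚ)

  slackS : State n m → Fin m → Bool
  slackS st s = does (W st s <? ρ ε ε>0 * c s)

  slackE : State n m → Fin n → Bool
  slackE st e = allFinB (λ s → not (mem s e) ∨ slackS st s)

  step : State n m → State n m
  step st = record
    { w  = λ e → if slackE st e then (1ℚ + ε) * w st e else w st e
    ; ℓE = λ e → if slackE st e then ℓE st e ∸ 1 else ℓE st e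
    ; ℓS = λ s → if slackS st s then ℓS st s ∸ 1 else ℓS st s
    }

  initial : ℕ → State n m
  initial L = record
    { w  = λ _ → pow (ρ ε ε>0) L
    ; ℓE = λ _ → L
    ; ℓS = λ _ → L
    }

  iterate : ℕ → State n m → State n m
  iterate zero    st = st
  iterate (suc k) st = iterate k (step st)

  final : ℕ → State n m
  final L = iterate L (initial L)

module Submission where

open import Defs
open import Data.Nat using (ℕ; zero; suc)
open import Data.Fin using (Fin)
open import Data.Bool using (Bool; true)
open import Data.Product using (_×_; ∃)
open import Data.Rational using (ℚ; 0ℚ; 1ℚ; ½; _<_; _≤_; _*_)
open import Relation.Binary.PropositionalEquality using (_≡_)

import Data.Nat as N
import Data.Nat.Properties as NP
import Data.Nat.Coprimality as Coprime
import Data.Fin as F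
open import Data.Bool using (false; if_then_else_; _∨_; not)
open import Data.Bool.Properties using (not-¬)
open import Data.Product using (_,_; proj₁; proj₂)
open import Data.Empty using (⊥-elim)
open import Data.Integer using (+_)
import Data.Integer.Solver as ℤSolver
import Data.Rational as Q
import Data.Rational.Properties as QP
import Data.Rational.Unnormalised as U
import Data.Rational.Unnormalised.Properties as UP
import Data.Rational.Solver as ℚSolver
open import Function using (_∘_)
open import Relation.Binary.PropositionalEquality
open import Relation.Nullary using (Dec; does; yes; no; ¬_)
open import Relation.Nullary.Decidable using (dec-true)

-- Write q = 1+ε and r = q⁻¹, and let run k be the state after k
-- rounds, started from initial weights r^L.  Three invariants drive the proof:
--  * weights never decrease, so a set that stops being slack never becomes
--    slack again, and an element slack in round k was raised in every round
--    so far, hence has weight q^k r^L;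
--  * feasibility W(s) ≤ c_s is preserved: a slack set has W < r c_s and grows
--    by at most a factor q, a tight set contains only tight elements and keeps
--    its weight; initially W(s) ≤ n r^L ≤ 1/C ≤ c_s by the choice of L;
--  * a set is slack in round k only if it was slack in every earlier round,
--    so then its level is exactly L − k.
-- At the end (L = K+1 rounds) a set of positive level is tight, giving both
-- bounds.  A set of level 0 was slack in the last round K; any of its elements
-- that was slack too would reach weight q^L r^L = 1 > W(s), so none was, and
-- W(s) kept its value below r c_s.

does-true⇒ : ∀ {P : Set} (d : Dec P) → does d ≡ true → P
does-true⇒ (yes p) _ = p
does-true⇒ (no _)  ()

does-false⇒ : ∀ {P : Set} (d : Dec P) → does d ≡ false → ¬ P
does-false⇒ (yes _)  ()
does-false⇒ (no ¬p) _ = ¬p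

if-true : ∀ {A : Set} {b} {x y : A} → b ≡ true → (if b then x else y) ≡ x
if-true refl = refl

if-false : ∀ {A : Set} {b} {x y : A} → b ≡ false → (if b then x else y) ≡ y
if-false refl = refl

∨-monoʳ : ∀ a {b b′} → (b ≡ true → b′ ≡ true) → a ∨ b ≡ true → a ∨ b′ ≡ true
∨-monoʳ true  _     _ = refl
∨-monoʳ false b⇒b′ h = b⇒b′ h

allFinB-elim : ∀ {k} {f : Fin k → Bool} → allFinB f ≡ true → ∀ i → f i ≡ true
allFinB-elim {suc k} {f} h F.zero    with f F.zero | h
... | true | _ = refl
allFinB-elim {suc k} {f} h (F.suc i) with f F.zero | h
... | true | h′ = allFinB-elim h′ i

allFinB-intro : ∀ {k} {f : Fin k → Bool} → (∀ i → f i ≡ true) → allFinB f ≡ true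
allFinB-intro {zero}      _ = refl
allFinB-intro {suc k} {f} h rewrite h F.zero = allFinB-intro (h ∘ F.suc)

ℕtoℚ-mkℚ : ∀ k → ℕtoℚ k ≡ Q.mkℚ (+ k) 0 (Coprime.sym (Coprime.1-coprimeTo k))
ℕtoℚ-mkℚ k = QP.normalize-coprime (Coprime.sym (Coprime.1-coprimeTo k))

ℕtoℚ-suc : ∀ k → ℕtoℚ (suc k) ≡ 1ℚ Q.+ ℕtoℚ k
ℕtoℚ-suc k = QP.toℚᵘ-injective (UP.≃-trans unnormalised (UP.≃-sym (QP.toℚᵘ-homo-+ 1ℚ (ℕtoℚ k))))
  where
  open ℤSolver.+-*-Solver
  unnormalised : Q.toℚᵘ (ℕtoℚ (suc k)) U.≃ (Q.toℚᵘ 1ℚ U.+ Q.toℚᵘ (ℕtoℚ k))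
  unnormalised rewrite ℕtoℚ-mkℚ k | ℕtoℚ-mkℚ (suc k) =
    U.*≡* (solve 1 (λ x → (con (+ 1) :+ x) :* con (+ 1)
                         := (con (+ 1) :* con (+ 1) :+ x :* con (+ 1)) :* con (+ 1)) refl (+ k))

ℕtoℚ-nonneg : ∀ k → 0ℚ ≤ ℕtoℚ k
ℕtoℚ-nonneg k rewrite ℕtoℚ-mkℚ k = QP.nonNegative⁻¹ _

sumFin-mono : ∀ {k} {f g : Fin k → ℚ} → (∀ i → f i ≤ g i) → sumFin f ≤ sumFin g
sumFin-mono {zero}  _ = QP.≤-refl
sumFin-mono {suc k} h = QP.+-mono-≤ (h F.zero) (sumFin-mono (h ∘ F.suc))

sumFin-cong : ∀ {k} {f g : Fin k → ℚ} → (∀ i → f i ≡ g i) → sumFin f ≡ sumFin g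
sumFin-cong {zero}  _ = refl
sumFin-cong {suc k} h = cong₂ Q._+_ (h F.zero) (sumFin-cong (h ∘ F.suc))

sumFin-scale : ∀ {k} (a : ℚ) (f : Fin k → ℚ) → sumFin (λ i → a * f i) ≡ a * sumFin f
sumFin-scale {zero}  a f = sym (QP.*-zeroʳ a)
sumFin-scale {suc k} a f =
  trans (cong (a * f F.zero Q.+_) (sumFin-scale a (f ∘ F.suc))) (sym (QP.*-distribˡ-+ a _ _))

sumFin-const : ∀ k (x : ℚ) → sumFin {k} (λ _ → x) ≡ ℕtoℚ k * x
sumFin-const zero    x = sym (QP.*-zeroˡ x)
sumFin-const (suc k) x = begin
  x Q.+ sumFin {k} (λ _ → x)  ≡⟨ cong₂ Q._+_ (sym (QP.*-identityˡ x)) (sumFin-const k x) ⟩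
  1ℚ * x Q.+ ℕtoℚ k * x       ≡⟨ sym (QP.*-distribʳ-+ x 1ℚ (ℕtoℚ k)) ⟩
  (1ℚ Q.+ ℕtoℚ k) * x         ≡⟨ cong (_* x) (sym (ℕtoℚ-suc k)) ⟩
  ℕtoℚ (suc k) * x            ∎
  where open ≡-Reasoning

sumFin-nonneg : ∀ {k} {f : Fin k → ℚ} → (∀ i → 0ℚ ≤ f i) → 0ℚ ≤ sumFin f
sumFin-nonneg {k} {f} h =
  subst (_≤ sumFin f) (trans (sumFin-const k 0ℚ) (QP.*-zeroʳ (ℕtoℚ k))) (sumFin-mono h)

sumFin-≥-term : ∀ {k} {f : Fin k → ℚ} → (∀ i → 0ℚ ≤ f i) → ∀ j → f j ≤ sumFin f
sumFin-≥-term {suc k} {f} h F.zero =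
  subst (_≤ sumFin f) (QP.+-identityʳ (f F.zero)) (QP.+-mono-≤ (QP.≤-refl {f F.zero}) (sumFin-nonneg (h ∘ F.suc)))
sumFin-≥-term {suc k} {f} h (F.suc j) =
  subst (_≤ sumFin f) (QP.+-identityˡ (f (F.suc j))) (QP.+-mono-≤ (h F.zero) (sumFin-≥-term (h ∘ F.suc) j))

mul-nonneg : ∀ {a b} → 0ℚ ≤ a → 0ℚ ≤ b → 0ℚ ≤ a * b
mul-nonneg {a} {b} a≥0 b≥0 =
  QP.nonNegative⁻¹ _ {{QP.nonNeg*nonNeg⇒nonNeg a {{Q.nonNegative a≥0}} b {{Q.nonNegative b≥0}}}}

scale-up : ∀ {a x} → 1ℚ ≤ a → 0ℚ ≤ x → x ≤ a * x
scale-up {a} {x} 1≤a x≥0 =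
  subst (_≤ a * x) (QP.*-identityˡ x) (QP.*-monoʳ-≤-nonNeg x {{Q.nonNegative x≥0}} 1≤a)

cancel-inverse : ∀ {a b x y} → 0ℚ < a → a * b ≡ 1ℚ → x < b * y → a * x < y
cancel-inverse {a} {b} {x} {y} a>0 ab≡1 x<by =
  subst (a * x <_) ab·y≡y (QP.*-monoʳ-<-pos a {{Q.positive a>0}} x<by)
  where
  ab·y≡y : a * (b * y) ≡ y
  ab·y≡y = trans (sym (QP.*-assoc a b y)) (trans (cong (_* y) ab≡1) (QP.*-identityˡ y))

pow-nonneg : ∀ {x} → 0ℚ ≤ x → ∀ k → 0ℚ ≤ pow x k
pow-nonneg x≥0 zero    = QP.nonNegative⁻¹ 1ℚ
pow-nonneg x≥0 (suc k) = mul-nonneg x≥0 (pow-nonneg x≥0 k)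

pow-one : ∀ k → pow 1ℚ k ≡ 1ℚ
pow-one zero    = refl
pow-one (suc k) = trans (QP.*-identityˡ (pow 1ℚ k)) (pow-one k)

pow-*-distrib : ∀ a b k → pow a k * pow b k ≡ pow (a * b) k
pow-*-distrib a b zero    = refl
pow-*-distrib a b (suc k) =
  trans (interchange a (pow a k) b (pow b k)) (cong ((a * b) *_) (pow-*-distrib a b k))
  where
  open ℚSolver.+-*-Solver
  interchange : ∀ a x b y → (a * x) * (b * y) ≡ (a * b) * (x * y)
  interchange = solve 4 (λ a x b y → (a :* x) :* (b :* y) := (a :* b) :* (x :* y)) refl

pow-suc-≤ : ∀ {x} → 0ℚ ≤ x → x ≤ 1ℚ → ∀ k → pow x (suc k) ≤ pow x k
pow-suc-≤ {x} x≥0 x≤1 k =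
  subst (pow x (suc k) ≤_) (QP.*-identityˡ (pow x k))
        (QP.*-monoʳ-≤-nonNeg (pow x k) {{Q.nonNegative (pow-nonneg x≥0 k)}} x≤1)

module Growth (ε : ℚ) (ε>0 : 0ℚ < ε) where

  q : ℚ
  q = 1ℚ Q.+ ε

  r : ℚ
  r = ρ ε ε>0

  q>0 : 0ℚ < q
  q>0 = QP.+-mono-< {0ℚ} {1ℚ} {0ℚ} {ε} (QP.positive⁻¹ 1ℚ) ε>0

  1≤q : 1ℚ ≤ q
  1≤q = subst (_≤ q) (QP.+-identityʳ 1ℚ) (QP.+-monoʳ-≤ 1ℚ (QP.<⇒≤ ε>0))

  q*r≡1 : q * r ≡ 1ℚ
  q*r≡1 = QP.*-inverseʳ q {{Q.>-nonZero q>0}}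

  r≥0 : 0ℚ ≤ r
  r≥0 = QP.<⇒≤ (QP.positive⁻¹ _ {{QP.1/pos⇒pos q {{Q.positive q>0}}}})

  r≤1 : r ≤ 1ℚ
  r≤1 = subst (r ≤_) q*r≡1 (scale-up 1≤q r≥0)

  pow-inverse : ∀ k → pow q k * pow r k ≡ 1ℚ
  pow-inverse k = trans (pow-*-distrib q r k) (trans (cong (λ x → pow x k) q*r≡1) (pow-one k))

  -- The choice C N ≤ q^K makes the initial weights r^(K+1) of N elements
  -- sum to at most 1/C, the smallest admissible cost.
  initial-weight-bound : ∀ {C N : ℚ} (C>0 : 0ℚ < C) {K} → 0ℚ ≤ N → C * N ≤ pow q K
                       → N * pow r (suc K) ≤ inv C C>0
  initial-weight-bound {C} {N} C>0 {K} N≥0 CN≤qᴷ = begin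
    N * pow r (suc K)          ≤⟨ QP.*-monoˡ-≤-nonNeg N {{Q.nonNegative N≥0}} (pow-suc-≤ r≥0 r≤1 K) ⟩
    N * pow r K                ≡⟨ sym (QP.*-identityˡ _) ⟩
    1ℚ * (N * pow r K)         ≡⟨ cong (_* (N * pow r K)) (sym (QP.*-inverseˡ C {{Q.>-nonZero C>0}})) ⟩
    (C⁻¹ * C) * (N * pow r K)  ≡⟨ reassociate C⁻¹ C N (pow r K) ⟩
    C⁻¹ * ((C * N) * pow r K)  ≤⟨ QP.*-monoˡ-≤-nonNeg C⁻¹ {{Q.nonNegative C⁻¹≥0}}
                                    (QP.*-monoʳ-≤-nonNeg (pow r K) {{Q.nonNegative (pow-nonneg r≥0 K)}} CN≤qᴷ) ⟩
    C⁻¹ * (pow q K * pow r K)  ≡⟨ cong (C⁻¹ *_) (pow-inverse K) ⟩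
    C⁻¹ * 1ℚ                   ≡⟨ QP.*-identityʳ C⁻¹ ⟩
    C⁻¹                        ∎
    where
    open QP.≤-Reasoning
    C⁻¹ = inv C C>0
    C⁻¹≥0 : 0ℚ ≤ C⁻¹
    C⁻¹≥0 = QP.<⇒≤ (QP.positive⁻¹ _ {{QP.1/pos⇒pos C {{Q.positive C>0}}}})
    reassociate : ∀ a b x y → (a * b) * (x * y) ≡ a * ((b * x) * y)
    reassociate = solve 4 (λ a b x y → (a :* b) :* (x :* y) := a :* ((b :* x) :* y)) refl
      where open ℚSolver.+-*-Solver

module RoundAnalysis {n m : ℕ} (mem : Fin m → Fin n → Bool) (c : Fin m → ℚ)
                     (ε : ℚ) (ε>0 : 0ℚ < ε) (K : ℕ) where
  open Algorithm mem c ε ε>0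
  open Growth ε ε>0

  L : ℕ
  L = suc K

  run : ℕ → State n m
  run zero    = initial L
  run (suc k) = step (run k)

  -- iterate performs its first round first, so it agrees with run
  iterate-step : ∀ k st → iterate k (step st) ≡ step (iterate k st)
  iterate-step zero    st = refl
  iterate-step (suc k) st = iterate-step k (step st)

  final≡run : final L ≡ run L
  final≡run = iterate-run L
    where
    iterate-run : ∀ k → iterate k (initial L) ≡ run k
    iterate-run zero    = refl
    iterate-run (suc k) = trans (iterate-step k (initial L)) (cong step (iterate-run k))

  Certified : State n m → Fin m → Set
  Certified st s = (0 N.< ℓS st s → (r * c s ≤ W st s) × (W st s ≤ c s))
                 × (ℓS st s ≡ 0 → (0ℚ ≤ W st s) × (W st s < r * c s))

  share : State n m → Fin m → Fin n → ℚ
  share st s e = if mem s e then w st e else 0ℚ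

  slackS⇒ : ∀ st s → slackS st s ≡ true → W st s < r * c s
  slackS⇒ st s = does-true⇒ (W st s QP.<? r * c s)

  tightS⇒ : ∀ st s → slackS st s ≡ false → r * c s ≤ W st s
  tightS⇒ st s h = QP.≮⇒≥ (does-false⇒ (W st s QP.<? r * c s) h)

  ⇒slackS : ∀ st s → W st s < r * c s → slackS st s ≡ true
  ⇒slackS st s = dec-true (W st s QP.<? r * c s)

  tight-set⇒tight-element : ∀ st s e → slackS st s ≡ false → mem s e ≡ true → slackE st e ≡ false
  tight-set⇒tight-element st s e hs hm with slackE st e in he
  ... | false = refl
  ... | true  = ⊥-elim (not-¬ slack hs)
    where
    slack : slackS st s ≡ true
    slack = subst (λ b → not b ∨ slackS st s ≡ true) hm (allFinB-elim he s)

  w-nonneg : ∀ k e → 0ℚ ≤ w (run k) e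
  w-nonneg zero    e = pow-nonneg r≥0 L
  w-nonneg (suc k) e with slackE (run k) e
  ... | true  = QP.≤-trans (w-nonneg k e) (scale-up 1≤q (w-nonneg k e))
  ... | false = w-nonneg k e

  share-nonneg : ∀ k s e → 0ℚ ≤ share (run k) s e
  share-nonneg k s e with mem s e
  ... | true  = w-nonneg k e
  ... | false = QP.≤-refl

  W-mono : ∀ k s → W (run k) s ≤ W (run (suc k)) s
  W-mono k s = sumFin-mono share-mono
    where
    share-mono : ∀ e → share (run k) s e ≤ share (run (suc k)) s e
    share-mono e with mem s e
    ... | false = QP.≤-refl
    ... | true with slackE (run k) e
    ...   | true  = scale-up 1≤q (w-nonneg k e)
    ...   | false = QP.≤-refl

  W-growth : ∀ k s → W (run (suc k)) s ≤ q * W (run k) s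
  W-growth k s = subst (W (run (suc k)) s ≤_) (sumFin-scale q (share (run k) s)) (sumFin-mono share-growth)
    where
    share-growth : ∀ e → share (run (suc k)) s e ≤ q * share (run k) s e
    share-growth e with mem s e
    ... | false = QP.≤-reflexive (sym (QP.*-zeroʳ q))
    ... | true with slackE (run k) e
    ...   | true  = QP.≤-refl
    ...   | false = scale-up 1≤q (w-nonneg k e)

  W-unchanged : ∀ k s → (∀ e → mem s e ≡ true → slackE (run k) e ≡ false)
              → W (run (suc k)) s ≡ W (run k) s
  W-unchanged k s frozen = sumFin-cong share-unchanged
    where
    share-unchanged : ∀ e → share (run (suc k)) s e ≡ share (run k) s e
    share-unchanged e with mem s e in hm
    ... | false = refl
    ... | true  = if-false (frozen e hm)

  slackS-antitone : ∀ k s → slackS (run (suc k)) s ≡ true → slackS (run k) s ≡ true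
  slackS-antitone k s h = ⇒slackS (run k) s (QP.≤-<-trans (W-mono k s) (slackS⇒ (run (suc k)) s h))

  slackE-antitone : ∀ k e → slackE (run (suc k)) e ≡ true → slackE (run k) e ≡ true
  slackE-antitone k e h =
    allFinB-intro λ s → ∨-monoʳ (not (mem s e)) (slackS-antitone k s) (allFinB-elim h s)

  -- An element slack in round k has been raised in every round so far.
  raised-weight : ∀ k e → slackE (run k) e ≡ true → w (run (suc k)) e ≡ pow q (suc k) * pow r L
  slack-weight  : ∀ k e → slackE (run k) e ≡ true → w (run k) e ≡ pow q k * pow r L

  raised-weight k e h = begin
    w (run (suc k)) e          ≡⟨ if-true h ⟩
    q * w (run k) e            ≡⟨ cong (q *_) (slack-weight k e h) ⟩
    q * (pow q k * pow r L)    ≡⟨ sym (QP.*-assoc q (pow q k) (pow r L)) ⟩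
    pow q (suc k) * pow r L    ∎
    where open ≡-Reasoning

  slack-weight zero    e h = sym (QP.*-identityˡ (pow r L))
  slack-weight (suc k) e h = raised-weight k e (slackE-antitone k e h)

  ∸-suc : ∀ k → L N.∸ k N.∸ 1 ≡ L N.∸ suc k
  ∸-suc k = trans (NP.∸-+-assoc L k 1) (cong (L N.∸_) (NP.+-comm k 1))

  level-lower : ∀ k s → L N.∸ k N.≤ ℓS (run k) s
  level-lower zero    s = NP.≤-refl
  level-lower (suc k) s with slackS (run k) s
  ... | true  = subst (N._≤ ℓS (run k) s N.∸ 1) (∸-suc k) (NP.∸-monoˡ-≤ 1 (level-lower k s))
  ... | false = NP.≤-trans (NP.∸-monoʳ-≤ L (NP.n≤1+n k)) (level-lower k s)

  level-of-slack : ∀ k s → slackS (run k) s ≡ true → ℓS (run k) s ≡ L N.∸ k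
  level-of-slack zero    s h = refl
  level-of-slack (suc k) s h = begin
    ℓS (run (suc k)) s      ≡⟨ if-true (slackS-antitone k s h) ⟩
    ℓS (run k) s N.∸ 1      ≡⟨ cong (N._∸ 1) (level-of-slack k s (slackS-antitone k s h)) ⟩
    L N.∸ k N.∸ 1           ≡⟨ ∸-suc k ⟩
    L N.∸ suc k             ∎
    where open ≡-Reasoning

  feasible-step : ∀ k s → W (run k) s ≤ c s → W (run (suc k)) s ≤ c s
  feasible-step k s feasible with slackS (run k) s in hs
  ... | true  = QP.≤-trans (W-growth k s) (QP.<⇒≤ (cancel-inverse q>0 q*r≡1 (slackS⇒ (run k) s hs)))
  ... | false = subst (_≤ c s) (sym (W-unchanged k s (λ e → tight-set⇒tight-element (run k) s e hs)))
                      feasible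

  feasible : (∀ s → ℕtoℚ n * pow r L ≤ c s) → ∀ k s → W (run k) s ≤ c s
  feasible init zero    s = QP.≤-trans (sumFin-mono share≤rᴸ)
                                       (subst (_≤ c s) (sym (sumFin-const n (pow r L))) (init s))
    where
    share≤rᴸ : ∀ e → share (run zero) s e ≤ pow r L
    share≤rᴸ e with mem s e
    ... | true  = QP.≤-refl
    ... | false = pow-nonneg r≥0 L
  feasible init (suc k) s = feasible-step k s (feasible init k s)

  -- A set of positive final level is not slack at the end, so it is covered.
  positive-level⇒covered : ∀ s → 0 N.< ℓS (run L) s → r * c s ≤ W (run L) s
  positive-level⇒covered s pos with slackS (run L) s in hs
  ... | false = tightS⇒ (run L) s hs
  ... | true  = ⊥-elim (NP.<-irrefl (sym level-zero) pos)
    where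
    level-zero : ℓS (run L) s ≡ 0
    level-zero = trans (level-of-slack L s hs) (NP.n∸n≡0 L)

  zero-level⇒last-slack : ∀ s → ℓS (run L) s ≡ 0 → slackS (run K) s ≡ true
  zero-level⇒last-slack s level-zero with slackS (run K) s
  ... | true  = refl
  ... | false = ⊥-elim (NP.<-irrefl (sym level-zero)
                         (NP.<-≤-trans (NP.m<n⇒0<n∸m (NP.n<1+n K)) (level-lower K s)))

  -- An element slack in the last round ends with weight q^L r^L = 1.
  last-slack-weight : ∀ e → slackE (run K) e ≡ true → w (run L) e ≡ 1ℚ
  last-slack-weight e h = trans (raised-weight K e h) (pow-inverse L)

  -- A set of cost at most 1 that is slack in the last round keeps W < r c_s:
  -- a slack element of it would reach weight 1 > q W(s) ≥ W(s) at the end.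
  last-slack⇒stays-slack : ∀ s → c s ≤ 1ℚ → slackS (run K) s ≡ true → W (run L) s < r * c s
  last-slack⇒stays-slack s c≤1 hs = subst (_< r * c s) (sym (W-unchanged K s no-slack-element)) W<rc
    where
    W<rc : W (run K) s < r * c s
    W<rc = slackS⇒ (run K) s hs
    W<1 : W (run L) s < 1ℚ
    W<1 = QP.≤-<-trans (W-growth K s) (QP.<-≤-trans (cancel-inverse q>0 q*r≡1 W<rc) c≤1)
    no-slack-element : ∀ e → mem s e ≡ true → slackE (run K) e ≡ false
    no-slack-element e hm with slackE (run K) e in he
    ... | false = refl
    ... | true  = ⊥-elim (QP.<-irrefl refl (QP.≤-<-trans 1≤W W<1))
      where
      1≤W : 1ℚ ≤ W (run L) s
      1≤W = subst (_≤ W (run L) s) (trans (if-true hm) (last-slack-weight e he))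
                  (sumFin-≥-term (share-nonneg L s) e)

  certified : (∀ s → c s ≤ 1ℚ) → (∀ s → ℕtoℚ n * pow r L ≤ c s) → ∀ s → Certified (run L) s
  certified c≤1 init s =
      (λ pos → positive-level⇒covered s pos , feasible init L s)
    , (λ level-zero → sumFin-nonneg (share-nonneg L s)
                    , last-slack⇒stays-slack s (c≤1 s) (zero-level⇒last-slack s level-zero))

claimA4 : (n m : ℕ) (mem : Fin m → Fin n → Bool) (c : Fin m → ℚ)
          (C : ℚ) (C>0 : 0ℚ < C)
          → (∀ s → inv C C>0 ≤ c s × c s ≤ 1ℚ)
          → (∀ e → ∃ λ s → mem s e ≡ true)
          → (ε : ℚ) (ε>0 : 0ℚ < ε) → ε < ½
          → (K : ℕ) → IsCeilLog ε (C * ℕtoℚ n) K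
          → let open Algorithm mem c ε ε>0
                fin = final (suc K)
            in ∀ s →
                 (0 Data.Nat.< ℓS fin s →
                    (ρ ε ε>0 * c s ≤ W fin s) × (W fin s ≤ c s))
               × (ℓS fin s ≡ 0 →
                    (0ℚ ≤ W fin s) × (W fin s < ρ ε ε>0 * c s))
claimA4 n m mem c C C>0 cost-bounds _ ε ε>0 _ K (CN≤qᴷ , _) s =
  subst (λ st → Certified st s) (sym final≡run) (certified (proj₂ ∘ cost-bounds) initially-feasible s)
  where
  open RoundAnalysis mem c ε ε>0 K
  open Growth ε ε>0 using (initial-weight-bound)
  initially-feasible : ∀ s′ → ℕtoℚ n * pow (ρ ε ε>0) L ≤ c s′
  initially-feasible s′ = QP.≤-trans (initial-weight-bound C>0 {K} (ℕtoℚ-nonneg n) CN≤qᴷ) (proj₁ (cost-bounds s′))
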